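{- For every odd prime $p$, the function $k\mapsto \mathrm{fusc}(k)\bmod p$ on $\mathbb{N}$ is not eventually periodic.
   Context: Dijkstra's function $\mathrm{fusc}:\mathbb{N}\to\mathbb{N}$ (Stern's diatomic series) is defined by $\mathrm{fusc}(0)=0$, $\mathrm{fusc}(1)=1$, $\mathrm{fusc}(2n)=\mathrm{fusc}(n)$, $\mathrm{fusc}(2n+1)=\mathrm{fusc}(n)+\mathrm{fusc}(n+1)$. -}

module Defs where

open import Data.Nat using (ℕ; zero; suc; _+_; _*_; _%_; _≥_; _>_)
open import Data.Bool using (Bool; true; false)
open import Data.Product using (∃; ∃-syntax; _×_; _,_)
open import Relation.Binary.PropositionalEquality using (_≡_)

half : ℕ → ℕ
half zero          = zero
half (suc zero)    = zero
half (suc (suc m)) = suc (half m)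

odd : ℕ → Bool
odd zero          = false
odd (suc zero)    = true
odd (suc (suc m)) = odd m

-- Dijkstra's fusc, computed with a fuel argument (fuel n suffices for input n).
-- fusc 0 = 0, fusc 1 = 1, fusc (2m) = fusc m, fusc (2m+1) = fusc m + fusc (m+1).
fuscFuel : ℕ → ℕ → ℕ
fuscFuel zero    _             = 0
fuscFuel (suc f) zero          = 0
fuscFuel (suc f) (suc zero)    = 1
fuscFuel (suc f) n@(suc (suc _)) with odd n
... | false = fuscFuel f (half n)
... | true  = fuscFuel f (half n) + fuscFuel f (suc (half n))

fusc : ℕ → ℕ
fusc n = fuscFuel n n

EventuallyPeriodic : (ℕ → ℕ) → Set
EventuallyPeriodic f = ∃[ N ] ∃[ T ] (T > 0 × (∀ k → k ≥ N → f (k + T) ≡ f k))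

open import Data.List using (List; map; upTo)
_ : map fusc (upTo 20) ≡ 0 Data.List.∷ 1 Data.List.∷ 1 Data.List.∷ 2 Data.List.∷ 1 Data.List.∷ 3 Data.List.∷ 2 Data.List.∷ 3 Data.List.∷ 1 Data.List.∷ 4 Data.List.∷ 3 Data.List.∷ 5 Data.List.∷ 2 Data.List.∷ 5 Data.List.∷ 3 Data.List.∷ 4 Data.List.∷ 1 Data.List.∷ 5 Data.List.∷ 4 Data.List.∷ 7 Data.List.∷ Data.List.[]
_ = Relation.Binary.PropositionalEquality.refl
  where import Relation.Binary.PropositionalEquality

-- Suppose fusc mod p is periodic with period T from N on. Choose a ≥ N and
-- L ≥ 0 with 2^a ≡ 2^(a+L+1) (mod T). Since fusc (2^a k) = fusc k, scaling by
-- 2^a turns the eventual period T into the period 2^(L+1) − 1 valid from 1 on.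
-- But fusc (1 + 2^(L+1)) = L + 2 and fusc (2 + 2^(L+1)) = L + 1, while
-- fusc 2 = 1 and fusc 3 = 2; hence p ∣ L + 1 and L + 1 ≡ 2 (mod p), so p ∣ 2.
module Submission where

open import Defs
open import Data.Nat using (ℕ; _%_)
open import Data.Nat.Primality using (Prime; prime⇒nonZero)
open import Relation.Nullary using (¬_)
open import Relation.Binary.PropositionalEquality using (_≢_)

open import Data.Nat
  using (zero; suc; _+_; _*_; _∸_; _/_; _^_; _≤_; _<_; _≥_; z≤n; s≤s; NonZero; >-nonZero; nonTrivial⇒n>1)
open import Data.Nat.Properties
open import Data.Nat.DivMod using (m≡m%n+[m/n]*n; m%n<n)
open import Data.Nat.Divisibility using (_∣_; divides; ∣⇒≤; m%n≡0⇒n∣m; n∣m⇒m%n≡0)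
open import Data.Nat.Primality using (prime⇒nonTrivial)
open import Data.Bool using (true; false)
open import Data.Product using (∃₂; ∃-syntax; _×_; _,_)
open import Data.Fin using (toℕ; fromℕ<)
open import Data.Fin.Properties using (pigeonhole; toℕ-fromℕ<)
open import Relation.Binary.PropositionalEquality
open ≡-Reasoning

half≤ : ∀ n → half n ≤ n
half≤ zero          = z≤n
half≤ (suc zero)    = z≤n
half≤ (suc (suc n)) = s≤s (m≤n⇒m≤1+n (half≤ n))

odd⇒suc-half≤ : ∀ n → odd n ≡ true → suc (half n) ≤ n
odd⇒suc-half≤ (suc zero)    _ = s≤s z≤n
odd⇒suc-half≤ (suc (suc n)) _ = s≤s (s≤s (half≤ n))

fuscFuel-irrelevant : ∀ f g n → n ≤ f → n ≤ g → fuscFuel f n ≡ fuscFuel g n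
fuscFuel-irrelevant zero    zero    zero       _ _ = refl
fuscFuel-irrelevant zero    (suc g) zero       _ _ = refl
fuscFuel-irrelevant (suc f) zero    zero       _ _ = refl
fuscFuel-irrelevant (suc f) (suc g) zero       _ _ = refl
fuscFuel-irrelevant (suc f) (suc g) (suc zero) _ _ = refl
fuscFuel-irrelevant (suc f) (suc g) (suc (suc n)) (s≤s n<f) (s≤s n<g)
  with odd n in odd-n
     | (λ {m} (m≤ : m ≤ suc n) → fuscFuel-irrelevant f g m (≤-trans m≤ n<f) (≤-trans m≤ n<g))
... | false | IH = IH (s≤s (half≤ n))
... | true  | IH = cong₂ _+_ (IH (s≤s (half≤ n))) (IH (s≤s (odd⇒suc-half≤ n odd-n)))

fuscFuel-sufficient : ∀ {f n} → n ≤ f → fuscFuel f n ≡ fusc n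
fuscFuel-sufficient {f} {n} n≤f = fuscFuel-irrelevant f n n n≤f ≤-refl

odd-double : ∀ k → odd (2 * k) ≡ false
odd-double zero = refl
odd-double (suc k) = trans (cong odd (*-suc 2 k)) (odd-double k)

odd-suc-double : ∀ k → odd (suc (2 * k)) ≡ true
odd-suc-double zero = refl
odd-suc-double (suc k) = trans (cong (λ m → odd (suc m)) (*-suc 2 k)) (odd-suc-double k)

half-double : ∀ k → half (2 * k) ≡ k
half-double zero = refl
half-double (suc k) = trans (cong half (*-suc 2 k)) (cong suc (half-double k))

half-suc-double : ∀ k → half (suc (2 * k)) ≡ k
half-suc-double zero = refl
half-suc-double (suc k) = trans (cong (λ m → half (suc m)) (*-suc 2 k)) (cong suc (half-suc-double k))

fusc-2+n-even : ∀ n → odd n ≡ false → fusc (2 + n) ≡ fusc (suc (half n))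
fusc-2+n-even n odd-n rewrite odd-n = fuscFuel-sufficient (s≤s (half≤ n))

fusc-2+n-odd : ∀ n → odd n ≡ true → fusc (2 + n) ≡ fusc (suc (half n)) + fusc (2 + half n)
fusc-2+n-odd n odd-n rewrite odd-n =
  cong₂ _+_ (fuscFuel-sufficient (s≤s (half≤ n))) (fuscFuel-sufficient (s≤s (odd⇒suc-half≤ n odd-n)))

fusc-double : ∀ k → fusc (2 * k) ≡ fusc k
fusc-double zero    = refl
fusc-double (suc k) = begin
  fusc (2 * suc k)            ≡⟨ cong fusc (*-suc 2 k) ⟩
  fusc (2 + 2 * k)            ≡⟨ fusc-2+n-even (2 * k) (odd-double k) ⟩
  fusc (suc (half (2 * k)))   ≡⟨ cong (λ m → fusc (suc m)) (half-double k) ⟩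
  fusc (suc k)                ∎

fusc-suc-double : ∀ k → fusc (suc (2 * k)) ≡ fusc k + fusc (suc k)
fusc-suc-double zero    = refl
fusc-suc-double (suc k) = begin
  fusc (suc (2 * suc k))      ≡⟨ cong (λ m → fusc (suc m)) (*-suc 2 k) ⟩
  fusc (2 + suc (2 * k))      ≡⟨ fusc-2+n-odd (suc (2 * k)) (odd-suc-double k) ⟩
  fusc (suc (half (suc (2 * k)))) + fusc (2 + half (suc (2 * k)))
                              ≡⟨ cong (λ m → fusc (suc m) + fusc (2 + m)) (half-suc-double k) ⟩
  fusc (suc k) + fusc (2 + k) ∎

fusc-2^* : ∀ a k → fusc (2 ^ a * k) ≡ fusc k
fusc-2^* zero    k = cong fusc (+-identityʳ k)
fusc-2^* (suc a) k = begin
  fusc (2 * 2 ^ a * k)   ≡⟨ cong fusc (*-assoc 2 (2 ^ a) k) ⟩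
  fusc (2 * (2 ^ a * k)) ≡⟨ fusc-double (2 ^ a * k) ⟩
  fusc (2 ^ a * k)       ≡⟨ fusc-2^* a k ⟩
  fusc k                 ∎

fusc-2^ : ∀ n → fusc (2 ^ n) ≡ 1
fusc-2^ n = trans (cong fusc (sym (*-identityʳ (2 ^ n)))) (fusc-2^* n 1)

fusc-1+2^ : ∀ n → fusc (1 + 2 ^ n) ≡ 1 + n
fusc-1+2^ zero    = refl
fusc-1+2^ (suc n) = begin
  fusc (suc (2 * 2 ^ n))             ≡⟨ fusc-suc-double (2 ^ n) ⟩
  fusc (2 ^ n) + fusc (1 + 2 ^ n)    ≡⟨ cong₂ _+_ (fusc-2^ n) (fusc-1+2^ n) ⟩
  1 + (1 + n)                        ∎

fusc-2+2^ : ∀ n → fusc (2 + 2 ^ suc n) ≡ 1 + n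
fusc-2+2^ n = begin
  fusc (2 + 2 * 2 ^ n)   ≡⟨ cong fusc (*-distribˡ-+ 2 1 (2 ^ n)) ⟨
  fusc (2 * (1 + 2 ^ n)) ≡⟨ fusc-double (1 + 2 ^ n) ⟩
  fusc (1 + 2 ^ n)       ≡⟨ fusc-1+2^ n ⟩
  1 + n                  ∎

n<2^n : ∀ n → n < 2 ^ n
n<2^n zero    = s≤s z≤n
n<2^n (suc n) = subst (suc n <_) (cong (2 ^ n +_) (sym (+-identityʳ (2 ^ n))))
                      (+-mono-≤ (m^n>0 2 n) (n<2^n n))

m≤m*2^n : ∀ m n → m ≤ m * 2 ^ n
m≤m*2^n m n = m≤m*n m (2 ^ n) {{m^n≢0 2 n}}

[m+n]%d≡m%d⇒d∣n : ∀ m n d .{{_ : NonZero d}} → (m + n) % d ≡ m % d → d ∣ n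
[m+n]%d≡m%d⇒d∣n m n d eq = divides (q ∸ r) (begin
  n                                  ≡⟨ m+n∸m≡n m n ⟨
  m + n ∸ m                          ≡⟨ cong₂ _∸_ (m≡m%n+[m/n]*n (m + n) d) (m≡m%n+[m/n]*n m d) ⟩
  (m + n) % d + q * d ∸ (m % d + r * d)
                                     ≡⟨ cong (λ s → s + q * d ∸ (m % d + r * d)) eq ⟩
  m % d + q * d ∸ (m % d + r * d)    ≡⟨ [m+n]∸[m+o]≡n∸o (m % d) (q * d) (r * d) ⟩
  q * d ∸ r * d                      ≡⟨ *-distribʳ-∸ d q r ⟨
  (q ∸ r) * d                        ∎)
  where
  q = (m + n) / d
  r = m / d

mod-pigeonhole : ∀ (f : ℕ → ℕ) T .{{_ : NonZero T}} → ∃₂ λ i j → i < j × f i % T ≡ f j % T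
mod-pigeonhole f T with pigeonhole (n<1+n T) (λ i → fromℕ< (m%n<n (f (toℕ i)) T))
... | i , j , i<j , fi≡fj =
  toℕ i , toℕ j , i<j , trans (sym (toℕ-fromℕ< _)) (trans (cong toℕ fi≡fj) (toℕ-fromℕ< _))

powers-of-two-recur : ∀ N T .{{_ : NonZero T}} → ∃₂ λ a L → N ≤ a × T ∣ 2 ^ a * 2 ^ suc L ∸ 2 ^ a
powers-of-two-recur N T with mod-pigeonhole (λ i → 2 ^ (N + i)) T
... | i , j , i<j , same with m≤n⇒∃[o]m+o≡n i<j
... | L , refl = N + i , L , m≤m+n N i , [m+n]%d≡m%d⇒d∣n (2 ^ (N + i)) _ T (begin
  (2 ^ (N + i) + (2 ^ (N + i) * 2 ^ suc L ∸ 2 ^ (N + i))) % T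
    ≡⟨ cong (_% T) (m+[n∸m]≡n (m≤m*2^n (2 ^ (N + i)) (suc L))) ⟩
  2 ^ (N + i) * 2 ^ suc L % T  ≡⟨ cong (_% T) (^-distribˡ-+-* 2 (N + i) (suc L)) ⟨
  2 ^ (N + i + suc L) % T      ≡⟨ cong (λ k → 2 ^ k % T) (trans (+-assoc N i (suc L)) (cong (N +_) (+-suc i L))) ⟩
  2 ^ (N + suc (i + L)) % T    ≡⟨ same ⟨
  2 ^ (N + i) % T              ∎)

periodic-multiple : ∀ (g : ℕ → ℕ) {N T D} → (∀ k → k ≥ N → g (k + T) ≡ g k) →
                    T ∣ D → ∀ k → k ≥ N → g (k + D) ≡ g k
periodic-multiple g {N} {T} periodic (divides c refl) = shift c
  where
  shift : ∀ c k → k ≥ N → g (k + c * T) ≡ g k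
  shift zero    k k≥N = cong g (+-identityʳ k)
  shift (suc c) k k≥N = begin
    g (k + (T + c * T)) ≡⟨ cong (λ m → g (k + m)) (+-comm T (c * T)) ⟩
    g (k + (c * T + T)) ≡⟨ cong g (+-assoc k (c * T) T) ⟨
    g (k + c * T + T)   ≡⟨ periodic (k + c * T) (≤-trans k≥N (m≤m+n k (c * T))) ⟩
    g (k + c * T)       ≡⟨ shift c k k≥N ⟩
    g k                 ∎

fusc-mod-recurs : ∀ p .{{_ : NonZero p}} → EventuallyPeriodic (λ k → fusc k % p) →
                  ∃[ L ] ∀ y → fusc (y + 2 ^ suc L) % p ≡ fusc (suc y) % p
fusc-mod-recurs p (N , T , T>0 , periodic) with powers-of-two-recur N T {{>-nonZero T>0}}
... | a , L , N≤a , T∣D = L , λ y → begin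
  fusc (y + 2 ^ suc L) % p       ≡⟨ cong (_% p) (fusc-2^* a (y + 2 ^ suc L)) ⟨
  fusc (e * (y + 2 ^ suc L)) % p ≡⟨ cong (λ k → fusc k % p) (regroup y) ⟩
  fusc (e * suc y + D) % p
    ≡⟨ periodic-multiple (λ k → fusc k % p) periodic T∣D (e * suc y) (N≤e* y) ⟩
  fusc (e * suc y) % p           ≡⟨ cong (_% p) (fusc-2^* a (suc y)) ⟩
  fusc (suc y) % p               ∎
  where
  e = 2 ^ a
  D = e * 2 ^ suc L ∸ e
  regroup : ∀ y → e * (y + 2 ^ suc L) ≡ e * suc y + D
  regroup y = begin
    e * (y + 2 ^ suc L)   ≡⟨ *-distribˡ-+ e y (2 ^ suc L) ⟩
    e * y + e * 2 ^ suc L ≡⟨ cong (e * y +_) (m+[n∸m]≡n (m≤m*2^n e (suc L))) ⟨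
    e * y + (e + D)       ≡⟨ +-assoc (e * y) e D ⟨
    e * y + e + D         ≡⟨ cong (_+ D) (trans (+-comm (e * y) e) (sym (*-suc e y))) ⟩
    e * suc y + D         ∎
  N≤e* : ∀ y → N ≤ e * suc y
  N≤e* y = ≤-trans N≤a (≤-trans (<⇒≤ (n<2^n a)) (m≤m*n e (suc y)))

fusc-recurrence⇒∣2 : ∀ p .{{_ : NonZero p}} L →
                     (∀ y → fusc (y + 2 ^ suc L) % p ≡ fusc (suc y) % p) → p ∣ 2
fusc-recurrence⇒∣2 p L recur = m%n≡0⇒n∣m 2 p (begin
  2 % p                    ≡⟨ recur 2 ⟨
  fusc (2 + 2 ^ suc L) % p ≡⟨ cong (_% p) (fusc-2+2^ L) ⟩
  suc L % p                ≡⟨ n∣m⇒m%n≡0 (suc L) p p∣1+L ⟩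
  0                        ∎)
  where
  p∣1+L : p ∣ suc L
  p∣1+L = [m+n]%d≡m%d⇒d∣n 1 (suc L) p (begin
    (1 + suc L) % p          ≡⟨ cong (_% p) (fusc-1+2^ (suc L)) ⟨
    fusc (1 + 2 ^ suc L) % p ≡⟨ recur 1 ⟩
    1 % p                    ∎)

mainTheorem19 : (p : ℕ) → (pp : Prime p) → p ≢ 2 →
    ¬ EventuallyPeriodic (λ k → _%_ (fusc k) p ⦃ prime⇒nonZero pp ⦄)
mainTheorem19 p pp p≢2 periodic =
  p≢2 (≤-antisym (∣⇒≤ p∣2) (nonTrivial⇒n>1 p {{prime⇒nonTrivial pp}}))
  where
  instance
    p≢0 : NonZero p
    p≢0 = prime⇒nonZero pp
  p∣2 : p ∣ 2
  p∣2 = let L , recur = fusc-mod-recurs p periodic in fusc-recurrence⇒∣2 p L recur
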